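{- Let $m \geq 1$, let $t = (t_0, \dotsc, t_{m-1})$ be Boolean input variables and let $\Gamma = (\circ_0, \dotsc, \circ_{m-2})$ with each $\circ_i \in \{\textsc{And}, \textsc{Or}\}$. Then the set of prime implicants of the generalized And-Or path $h(t;\Gamma)$ is \[\Big\{\, t_i \land \bigwedge_{j < i,\ \circ_j = \textsc{And}} t_j \;:\; t_i \in S^{\textsc{Or}} \,\Big\},\] where $S^{\textsc{Or}}$ is the set consisting of all inputs $t_i$ with $i \le m-2$ and $\circ_i = \textsc{Or}$, together with $t_{m-1}$.
   Context: For inputs $t = (t_0,\dotsc,t_{m-1})$ and gate types $\Gamma=(\circ_0,\dotsc,\circ_{m-2})$, $\circ_i \in\{\textsc{And},\textsc{Or}\}$ (binary logical And / Or), the generalized And-Or path is the Boolean function $h(t;\Gamma) := t_0 \circ_0 (t_1 \circ_1 (t_2 \circ_2 ( \dotsb \circ_{m-3} (t_{m-2} \circ_{m-2} t_{m-1}))))$. For $i \le m-2$, $\circ_i$ is called the gate type of $t_i$. A literal of a Boolean function $f$ on inputs $t_0,\dotsc,t_{m-1}$ is $t_i$ or $\overline{t_i}$. A conjunction $\iota$ of literals is an implicant of $f$ if every $\alpha\in\{0,1\}^m$ with $\iota(\alpha)=1$ satisfies $f(\alpha)=1$; it is a prime implicant if no implicant $\pi$ of $f$ has a set of literals strictly contained in that of $\iota$. -}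

module Defs where

open import Data.Bool using (Bool; true; false; _∧_; _∨_; if_then_else_)
open import Data.Nat using (ℕ; zero; suc; _<ᵇ_)
open import Data.Fin using (Fin; zero; suc; toℕ; _≟_)
open import Data.Vec using (Vec; []; _∷_)
open import Data.Maybe using (Maybe; just; nothing)
open import Data.Product using (Σ; _×_; ∃)
open import Data.Sum using (_⊎_)
open import Relation.Nullary using (¬_)
open import Relation.Nullary.Decidable using (⌊_⌋)
open import Relation.Binary.PropositionalEquality using (_≡_; _≢_)

data Gate : Set where
  And Or : Gate

applyGate : Gate → Bool → Bool → Bool
applyGate And a b = a ∧ b
applyGate Or  a b = a ∨ b

andOrPath : ∀ {n} → Vec Gate n → (Fin (suc n) → Bool) → Bool
andOrPath []      t = t zero
andOrPath (g ∷ Γ) t = applyGate g (t zero) (andOrPath Γ (λ i → t (suc i)))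

-- Gate type of input t_i (nothing for the last input t_{m-1}).
gateOf : ∀ {n} → Vec Gate n → Fin (suc n) → Maybe Gate
gateOf []      zero    = nothing
gateOf (g ∷ Γ) zero    = just g
gateOf (g ∷ Γ) (suc i) = gateOf Γ i

-- A conjunction of literals over inputs t_0..t_{m-1}: for each variable,
-- nothing = does not occur, just true = literal t_i, just false = literal ¬t_i.
Conj : ℕ → Set
Conj m = Fin m → Maybe Bool

Satisfies : ∀ {m} → Conj m → (Fin m → Bool) → Set
Satisfies ι α = ∀ j b → ι j ≡ just b → α j ≡ b

IsImplicant : ∀ {m} → ((Fin m → Bool) → Bool) → Conj m → Set
IsImplicant f ι = ∀ α → Satisfies ι α → f α ≡ true

StrictSub : ∀ {m} → Conj m → Conj m → Set
StrictSub π ι = (∀ j b → π j ≡ just b → ι j ≡ just b) × ∃ (λ j → π j ≢ ι j)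

IsPrimeImplicant : ∀ {m} → ((Fin m → Bool) → Bool) → Conj m → Set
IsPrimeImplicant f ι = IsImplicant f ι × (∀ π → StrictSub π ι → ¬ IsImplicant f π)

InSOr : ∀ {n} → Vec Gate n → Fin (suc n) → Set
InSOr {n} Γ i = (gateOf Γ i ≡ just Or) ⊎ (toℕ i ≡ n)

isAnd : Maybe Gate → Bool
isAnd (just And) = true
isAnd _          = false

pathConj : ∀ {n} → Vec Gate n → Fin (suc n) → Conj (suc n)
pathConj Γ i j =
  if ⌊ j ≟ i ⌋ ∨ ((toℕ j <ᵇ toℕ i) ∧ isAnd (gateOf Γ j)) then just true else nothing

{-# OPTIONS --safe #-}
module Submission where

-- An assignment α satisfies h(t;Γ) iff, for some t_i ∈ S^Or, it sets t_i and
-- every And-input before t_i to 1: the path is decided at the first Or-input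
-- that is 1 (or at t_{m-1}), provided all And-inputs before it are 1. Hence
-- every implicant contains one of the conjunctions P_i := t_i ∧ ⋀_{j<i, ∘_j=And} t_j
-- with t_i ∈ S^Or (evaluate h at its positive literals), and each P_i is an
-- implicant. No P_k with k ≠ i lies inside P_i, because the only S^Or-input
-- occurring in P_i is t_i itself; so the P_i are exactly the minimal implicants.

open import Defs
open import Data.Nat using (ℕ; suc; pred; _<_; _<ᵇ_)
open import Data.Nat.Properties using (<ᵇ⇒<; <-irrefl; <-≤-trans; ≤-pred)
open import Data.Fin using (Fin; zero; suc; toℕ; _≟_)
open import Data.Fin.Properties using (toℕ<n)
open import Data.Vec using (Vec; []; _∷_)
open import Data.Bool using (Bool; true; false; T)
open import Data.Bool.Properties using (∨-zeroʳ) renaming (_≟_ to _≟ᵇ_)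
open import Data.Maybe using (just; nothing; fromMaybe)
open import Data.Maybe.Properties using (≡-dec)
open import Data.Product using (_×_; ∃; _,_)
open import Data.Sum using (_⊎_; inj₁; inj₂)
open import Data.Empty using (⊥-elim)
open import Relation.Nullary using (¬_; yes; no)
open import Relation.Binary.PropositionalEquality using (_≡_; _≢_; refl; sym; trans; subst; cong)

_⊆_ : ∀ {m} → Conj m → Conj m → Set
π ⊆ ι = ∀ j b → π j ≡ just b → ι j ≡ just b

⊆-antisym : ∀ {m} {π ι : Conj m} → π ⊆ ι → ι ⊆ π → ∀ j → π j ≡ ι j
⊆-antisym {π = π} {ι} π⊆ι ι⊆π j with π j in πj | ι j in ιj
... | just b  | _      = trans (sym (π⊆ι j b πj)) ιj
... | nothing | nothing = refl
... | nothing | just c with trans (sym πj) (ι⊆π j c ιj)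
...   | ()

positivePart : ∀ {m} → Conj m → (Fin m → Bool)
positivePart ι j = fromMaybe false (ι j)

satisfies-positivePart : ∀ {m} (ι : Conj m) → Satisfies ι (positivePart ι)
satisfies-positivePart ι j b ιj rewrite ιj = refl

positivePart-true : ∀ {m} (ι : Conj m) j → positivePart ι j ≡ true → ι j ≡ just true
positivePart-true ι j e with ι j
... | just true = refl

InSOr-suc : ∀ {n} g (Γ : Vec Gate n) i → InSOr Γ i → InSOr (g ∷ Γ) (suc i)
InSOr-suc g Γ i (inj₁ or) = inj₁ or
InSOr-suc g Γ i (inj₂ last) = inj₂ (cong suc last)

InSOr-pred : ∀ {n} g (Γ : Vec Gate n) i → InSOr (g ∷ Γ) (suc i) → InSOr Γ i
InSOr-pred g Γ i (inj₁ or) = inj₁ or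
InSOr-pred g Γ i (inj₂ last) = inj₂ (cong pred last)

InSOr-notAndBefore : ∀ {n} (Γ : Vec Gate n) k i →
  InSOr Γ k → toℕ k < toℕ i → gateOf Γ k ≢ just And
InSOr-notAndBefore Γ k i (inj₁ or) _ and with trans (sym or) and
... | ()
InSOr-notAndBefore Γ k i (inj₂ last) k<i _ =
  <-irrefl refl (<-≤-trans (subst (_< toℕ i) last k<i) (≤-pred (toℕ<n i)))

pathConj-suc : ∀ {n} g (Γ : Vec Gate n) i j → pathConj (g ∷ Γ) (suc i) (suc j) ≡ pathConj Γ i j
pathConj-suc g Γ i j with j ≟ i
... | yes _ = refl
... | no _  = refl

pathConj-self : ∀ {n} (Γ : Vec Gate n) i → pathConj Γ i i ≡ just true
pathConj-self Γ i with i ≟ i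
... | yes _  = refl
... | no i≢i = ⊥-elim (i≢i refl)

pathConj-just : ∀ {n} (Γ : Vec Gate n) i j {b} → pathConj Γ i j ≡ just b →
  b ≡ true × (j ≡ i ⊎ (toℕ j < toℕ i × gateOf Γ j ≡ just And))
pathConj-just Γ i j e with j ≟ i | toℕ j <ᵇ toℕ i in j<ᵇi | gateOf Γ j
pathConj-just Γ i j refl | yes j≡i | _ | _ = refl , inj₁ j≡i
pathConj-just Γ i j refl | no _ | true | just And =
  refl , inj₂ (<ᵇ⇒< (toℕ j) (toℕ i) (subst T (sym j<ᵇi) _) , refl)

pathConj-InSOr : ∀ {n} (Γ : Vec Gate n) {i k b} → InSOr Γ k → pathConj Γ i k ≡ just b → k ≡ i
pathConj-InSOr Γ {i} {k} k∈SOr e with pathConj-just Γ i k e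
... | _ , inj₁ k≡i = k≡i
... | _ , inj₂ (k<i , and) = ⊥-elim (InSOr-notAndBefore Γ k i k∈SOr k<i and)

pathConj-implicant : ∀ {n} (Γ : Vec Gate n) {i} → InSOr Γ i → IsImplicant (andOrPath Γ) (pathConj Γ i)
pathConj-implicant [] {zero} _ α sat = sat zero true refl
pathConj-implicant (And ∷ Γ) {zero} (inj₁ ())
pathConj-implicant (And ∷ Γ) {zero} (inj₂ ())
pathConj-implicant (Or  ∷ Γ) {zero} _ α sat rewrite sat zero true refl = refl
pathConj-implicant (g ∷ Γ) {suc i} i∈SOr α sat
  with pathConj-implicant Γ (InSOr-pred g Γ i i∈SOr) (λ j → α (suc j))
         (λ j b e → sat (suc j) b (trans (pathConj-suc g Γ i j) e))
pathConj-implicant (And ∷ Γ) {suc i} _ α sat | rest rewrite sat zero true refl = rest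
pathConj-implicant (Or  ∷ Γ) {suc i} _ α sat | rest rewrite rest = ∨-zeroʳ (α zero)

satisfies-pathConj-suc : ∀ {n} g (Γ : Vec Gate n) i α →
  (g ≡ And → α zero ≡ true) → Satisfies (pathConj Γ i) (λ j → α (suc j)) →
  Satisfies (pathConj (g ∷ Γ) (suc i)) α
satisfies-pathConj-suc And Γ i α α₀ sat zero .true refl = α₀ refl
satisfies-pathConj-suc Or  Γ i α α₀ sat zero b ()
satisfies-pathConj-suc g   Γ i α α₀ sat (suc j) b e = sat j b (trans (sym (pathConj-suc g Γ i j)) e)

andOrPath-true⇒pathConj : ∀ {n} (Γ : Vec Gate n) α → andOrPath Γ α ≡ true →
  ∃ λ i → InSOr Γ i × Satisfies (pathConj Γ i) α
andOrPath-true⇒pathConj [] α e = zero , inj₂ refl , λ { zero .true refl → e }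
andOrPath-true⇒pathConj (g ∷ Γ) α e with α zero in α₀
andOrPath-true⇒pathConj (Or ∷ Γ) α e | true =
  zero , inj₁ refl , λ { zero .true refl → α₀ ; (suc j) b () }
andOrPath-true⇒pathConj (And ∷ Γ) α () | false
andOrPath-true⇒pathConj (Or ∷ Γ) α e | false
  with andOrPath-true⇒pathConj Γ (λ j → α (suc j)) e
... | i , i∈SOr , sat = suc i , InSOr-suc Or Γ i i∈SOr , satisfies-pathConj-suc Or Γ i α (λ ()) sat
andOrPath-true⇒pathConj (And ∷ Γ) α e | true
  with andOrPath-true⇒pathConj Γ (λ j → α (suc j)) e
... | i , i∈SOr , sat = suc i , InSOr-suc And Γ i i∈SOr , satisfies-pathConj-suc And Γ i α (λ _ → α₀) sat

implicant-contains-pathConj : ∀ {n} (Γ : Vec Gate n) {ι} → IsImplicant (andOrPath Γ) ι →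
  ∃ λ i → InSOr Γ i × pathConj Γ i ⊆ ι
implicant-contains-pathConj Γ {ι} implicant
  with andOrPath-true⇒pathConj Γ (positivePart ι) (implicant _ (satisfies-positivePart ι))
... | i , i∈SOr , sat = i , i∈SOr , contained
  where
  contained : pathConj Γ i ⊆ ι
  contained j b e with pathConj-just Γ i j e
  ... | refl , _ = positivePart-true ι j (sat j true e)

prime⇒pathConj : ∀ {n} (Γ : Vec Gate n) {ι} → IsPrimeImplicant (andOrPath Γ) ι →
  ∃ λ i → InSOr Γ i × (∀ j → ι j ≡ pathConj Γ i j)
prime⇒pathConj Γ {ι} (implicant , prime) with implicant-contains-pathConj Γ implicant
... | i , i∈SOr , Pᵢ⊆ι = i , i∈SOr , equal
  where
  equal : ∀ j → ι j ≡ pathConj Γ i j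
  equal j with ≡-dec _≟ᵇ_ (ι j) (pathConj Γ i j)
  ... | yes ιj≡Pᵢj = ιj≡Pᵢj
  ... | no ιj≢Pᵢj =
    ⊥-elim (prime (pathConj Γ i) (Pᵢ⊆ι , j , λ e → ιj≢Pᵢj (sym e)) (pathConj-implicant Γ i∈SOr))

pathConj-prime : ∀ {n} (Γ : Vec Gate n) {i ι} → InSOr Γ i → (∀ j → ι j ≡ pathConj Γ i j) →
  IsPrimeImplicant (andOrPath Γ) ι
pathConj-prime Γ {i} {ι} i∈SOr ι≡Pᵢ = implicant , prime
  where
  implicant : IsImplicant (andOrPath Γ) ι
  implicant α sat = pathConj-implicant Γ i∈SOr α (λ j b e → sat j b (trans (ι≡Pᵢ j) e))

  prime : ∀ π → StrictSub π ι → ¬ IsImplicant (andOrPath Γ) π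
  prime π (π⊆ι , j , πj≢ιj) implicantπ with implicant-contains-pathConj Γ implicantπ
  ... | k , k∈SOr , Pₖ⊆π with pathConj-InSOr Γ k∈SOr (trans (sym (ι≡Pᵢ k)) (π⊆ι k true (Pₖ⊆π k true (pathConj-self Γ k))))
  ... | refl = πj≢ιj (⊆-antisym π⊆ι (λ j b e → Pₖ⊆π j b (trans (sym (ι≡Pᵢ j)) e)) j)

mainTheorem1 : (n : ℕ) (Γ : Vec Gate n) (ι : Conj (suc n)) →
    (IsPrimeImplicant (andOrPath Γ) ι →
      ∃ (λ (i : Fin (suc n)) → InSOr Γ i × (∀ j → ι j ≡ pathConj Γ i j)))
    × ((∃ (λ (i : Fin (suc n)) → InSOr Γ i × (∀ j → ι j ≡ pathConj Γ i j))) →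
      IsPrimeImplicant (andOrPath Γ) ι)
mainTheorem1 n Γ ι = prime⇒pathConj Γ , λ (i , i∈SOr , ι≡Pᵢ) → pathConj-prime Γ i∈SOr ι≡Pᵢ
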